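{- Let $\mathcal{S}_T$ be a state of the rotor-router system on $G$ and let $\Delta t\ge 1$ be an integer. The following statements are equivalent: (i) $\mathcal{S}_T$ admits a $\Delta t$-step subcycle decomposition; (ii) for every vertex $v$ and all $t,t'$ with $[t,t')\subseteq[T,T+\Delta t)$, the multisets $\{\!\{\mathcal{C}_t^{t'}(e)\}\!\}_{e\in\mathrm{in}(v)}$ and $\{\!\{\mathcal{C}_{t+1}^{t'+1}(e)\}\!\}_{e\in\mathrm{out}(v)}$ are equal; (iii) for all $t,t'$ with $[t,t')\subseteq[T,T+\Delta t)$, the multisets $\{\!\{\mathcal{C}_t^{t'}(e)\}\!\}_{e\in\vec E}$ and $\{\!\{\mathcal{C}_{t+1}^{t'+1}(e)\}\!\}_{e\in\vec E}$ are equal; (iv) for every $0\le i\le \Delta t$, $\Phi_i(\mathcal{S}_T)=\Phi_i(\mathcal{S}_{T+1})=\cdots=\Phi_i(\mathcal{S}_{T+\Delta t-i+1})$; (v) for every vertex $v$, all $e_1,e_2\in\mathrm{in}(v)$ and all $t,t'$ with $[t,t')\subseteq[T,T+\Delta t)$, $|\mathcal{C}_t^{t'}(e_1)-\mathcal{C}_t^{t'}(e_2)|\le 1$.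
   Context: Rotor-router model: $G=(V,E)$ is a finite connected undirected graph with $m$ edges; $\vec G=(V,\vec E)$ replaces each edge $\{u,v\}$ by arcs $(u,v),(v,u)$; $\mathrm{in}(v),\mathrm{out}(v)$ denote incoming/outgoing arcs of $v$. Each vertex $v$ has a fixed cyclic ordering $\rho_v$ of $\mathrm{out}(v)$, with $\mathit{next}(e)$ the successor of $e$ in $\rho_v$. A state $\mathcal{S}_t$ consists of a pointer $\mathit{pointer}_v\in\mathrm{out}(v)$ and a number of identical tokens at each vertex $v$. In each synchronous step every vertex $v$, while it has tokens, sends one token along $\mathit{pointer}_v$ and sets $\mathit{pointer}_v:=\mathit{next}(\mathit{pointer}_v)$; tokens sent at step $t$ are at the heads of their arcs at time $t+1$. $\mathcal{L}_t(e)$ is the number of tokens sent along arc $e$ at step $t$; $\mathcal{C}_{t_1}^{t_2}(e)=\sum_{t_1\le t<t_2}\mathcal{L}_t(e)$; $[a,b)=\{a,\dots,b-1\}$; $\{\!\{\cdot\}\!\}$ denotes a multiset. The $i$-th potential is $\Phi_i(\mathcal{S}_t)=\sum_{e\in\vec E}(\mathcal{C}_t^{t+i}(e))^2$. A state $\mathcal{S}_T$ admits a $\Delta t$-step subcycle decomposition if for every vertex $v$ there is a bijection $M_v:\mathrm{in}(v)\to\mathrm{out}(v)$ such that $\mathcal{L}_t(e)=\mathcal{L}_{t+1}(M_v(e))$ for all $e\in\mathrm{in}(v)$ and all $t\in[T,T+\Delta t)$. -}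

module Defs where

open import Data.Nat using (ℕ; zero; suc; _+_; _∸_; _^_; _%_; _≤_; _<_; ∣_-_∣)
open import Data.Nat.DivMod using (m%n<n)
open import Data.Fin using (Fin; toℕ; fromℕ<; _≟_)
open import Data.Product using (Σ; _,_; ∃; _×_)
open import Function.Bundles using (_⤖_; Bijection)
open import Data.List.Relation.Binary.Permutation.Propositional using (_↭_)
open import Data.List using (List; map; concatMap; filter; allFin)
open import Data.Bool using (if_then_else_)
open import Relation.Nullary using (does; ¬_)
open import Relation.Binary.PropositionalEquality using (_≡_)

next : ∀ {d} → Fin d → Fin d
next {suc d} i = fromℕ< (m%n<n (suc (toℕ i)) (suc d))

data Walk {n : ℕ} (deg : Fin n → ℕ) (nbr : (v : Fin n) → Fin (deg v) → Fin n)
          : Fin n → Fin n → Set where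
  here  : ∀ {v} → Walk deg nbr v v
  there : ∀ {v w} (i : Fin (deg v)) → Walk deg nbr (nbr v i) w → Walk deg nbr v w

-- A finite connected simple undirected graph, presented with a rotor
-- ordering: the out-arcs of v are (v , i) for i : Fin (deg v), arc (v , i)
-- leads to nbr v i, and the cyclic ordering ρ_v is i ↦ next i.
record Graph : Set where
  field
    n         : ℕ
    deg       : Fin n → ℕ
    nbr       : (v : Fin n) → Fin (deg v) → Fin n
    noLoop    : ∀ v i → ¬ (nbr v i ≡ v)
    noMulti   : ∀ v i j → nbr v i ≡ nbr v j → i ≡ j
    symmetric : ∀ v i → ∃ λ j → nbr (nbr v i) j ≡ v
    nonempty  : Fin n
    connected : ∀ u w → Walk deg nbr u w

module _ (G : Graph) where
  open Graph G

  Arc : Set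
  Arc = Σ (Fin n) (λ v → Fin (deg v))

  tail : Arc → Fin n
  tail (v , _) = v

  head : Arc → Fin n
  head (v , i) = nbr v i

  InArc : Fin n → Set
  InArc v = Σ (Fin n) λ u → Σ (Fin (deg u)) λ i → nbr u i ≡ v

  inArc : ∀ {v} → InArc v → Arc
  inArc (u , i , _) = (u , i)

  allArcs : List Arc
  allArcs = concatMap (λ v → map (v ,_) (allFin (deg v))) (allFin n)

  outList : Fin n → List Arc
  outList v = map (v ,_) (allFin (deg v))

  inList : Fin n → List Arc
  inList v = filter (λ e → head e ≟ v) allArcs

  sumFin : (k : ℕ) → (Fin k → ℕ) → ℕ
  sumFin zero    f = 0
  sumFin (suc k) f = f Fin.zero + sumFin k (λ j → f (Fin.suc j))

  sumArcs : (Arc → ℕ) → ℕ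
  sumArcs f = sumFin n (λ v → sumFin (deg v) (λ i → f (v , i)))

  record State : Set where
    field
      pointer : (v : Fin n) → Fin (deg v)
      tokens  : Fin n → ℕ
  open State

  -- emit p k i : number of tokens sent along out-arc i when k tokens are
  -- sent one by one starting at pointer p (advancing the pointer each time)
  emit : ∀ {d} → Fin d → ℕ → Fin d → ℕ
  emit p zero    i = 0
  emit p (suc k) i = (if does (i ≟ p) then 1 else 0) + emit (next p) k i

  advance : ∀ {d} → Fin d → ℕ → Fin d
  advance p zero    = p
  advance p (suc k) = advance (next p) k

  load : State → Arc → ℕ
  load S (v , i) = emit (pointer S v) (tokens S v) i

  step : State → State
  step S = record
    { pointer = λ v → advance (pointer S v) (tokens S v)
    ; tokens  = λ w → sumArcs (λ e → if does (head e ≟ w) then load S e else 0) }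

  stateAt : State → ℕ → State
  stateAt S zero    = S
  stateAt S (suc t) = step (stateAt S t)

  -- L_t(e), times measured as offsets from the state S (= 𝒮_T)
  L : State → ℕ → Arc → ℕ
  L S t e = load (stateAt S t) e

  C : State → ℕ → ℕ → Arc → ℕ
  C S t1 t2 e = sumFin (t2 ∸ t1) (λ j → L S (t1 + toℕ j) e)

  Φ : ℕ → State → ℕ
  Φ i S = sumArcs (λ e → C S 0 i e ^ 2)

  -- definitions of (i)-(v), with S = 𝒮_T and times as offsets from T
  SubcycleDecomposition : State → ℕ → Set
  SubcycleDecomposition S Δt =
    ∀ v → Σ (InArc v ⤖ Fin (deg v)) λ M →
      ∀ (e : InArc v) t → t < Δt → L S t (inArc e) ≡ L S (suc t) (v , Bijection.to M e)

  -- [t , t') ⊆ [0 , Δt)  (only nonempty intervals matter: empty ones give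
  -- trivially true conditions)
  InWindow : ℕ → ℕ → ℕ → Set
  InWindow Δt t t' = t ≤ t' × t' ≤ Δt

  CondII : State → ℕ → Set
  CondII S Δt = ∀ v t t' → InWindow Δt t t' →
    map (C S t t') (inList v) ↭ map (C S (suc t) (suc t')) (outList v)

  CondIII : State → ℕ → Set
  CondIII S Δt = ∀ t t' → InWindow Δt t t' →
    map (C S t t') allArcs ↭ map (C S (suc t) (suc t')) allArcs

  CondIV : State → ℕ → Set
  CondIV S Δt = ∀ i → i ≤ Δt → ∀ s → s ≤ Δt ∸ i + 1 → Φ i (stateAt S s) ≡ Φ i S

  CondV : State → ℕ → Set
  CondV S Δt = ∀ v (e₁ e₂ : InArc v) t t' → InWindow Δt t t' →
    ∣ C S t t' (inArc e₁) - C S t t' (inArc e₂) ∣ ≤ 1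

-- (i) ⇒ (ii) ⇒ (iii) ⇒ (iv) is bookkeeping: a subcycle decomposition carries the window counts of
-- the in-arcs of v to those of its out-arcs one step later, multiplicities add up over vertices, and
-- Φ_i is the sum of squares of the multiset of window counts. For (iv) ⇒ (v): a rotor splits the
-- tokens it receives over a window into out-counts differing by at most one, and such a balanced
-- vector has the least sum of squares among vectors with the same sum, with equality only for
-- balanced vectors; so constancy of Φ_i forces the in-counts at every vertex to be balanced.
-- For (v) ⇒ (i): balanced cumulative counters never cross, so the in-arcs and the out-arcs of v can
-- each be sorted once for the whole window; sorted balanced vectors with equal sums coincide, and
-- matching in-arcs to out-arcs by rank gives the subcycle decomposition.

module Submission where

open import Defs
open import Data.Bool using (Bool; true; false; if_then_else_)
open import Data.Fin as Fin using (Fin; toℕ; fromℕ<; punchOut)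
open import Data.Fin.Permutation using (Permutation; permutation; flip; _∘ₚ_; _⟨$⟩ʳ_; _⟨$⟩ˡ_; inverseˡ; inverseʳ)
import Data.Fin.Properties as Finₚ
open import Data.List using (List; []; _∷_; _++_; map; concatMap; filter; tabulate)
import Data.List.Properties as Listₚ
open import Data.List.Membership.Propositional using (_∈_)
open import Data.List.Membership.Propositional.Properties using (∈-∃++)
open import Data.List.Relation.Binary.Permutation.Propositional using (_↭_; ↭-refl; ↭-sym; ↭-trans; ↭-prep)
open import Data.List.Relation.Binary.Permutation.Propositional.Properties using (shift; map⁺)
open import Data.List.Relation.Unary.Any using (here; there)
open import Data.Nat
open import Data.Nat.Properties
open import Data.Nat.DivMod
open import Data.Nat.Tactic.RingSolver using (solve-∀)
open import Algebra.Properties.CommutativeSemigroup +-commutativeSemigroup using (x∙yz≈y∙xz)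
open import Algebra.Properties.Semiring.Sum +-*-semiring
  using (sum; sum-cong-≗; sum-remove; sum-replicate-zero; ∑-distrib-+; ∑-comm; ∑-permute; *-distribˡ-sum)
import Data.Nat.ListAction as List
import Data.Nat.ListAction.Properties as List
open import Data.Empty using (⊥)
open import Data.Product using (Σ; _,_; ∃; _×_; proj₁; proj₂)
open import Data.Product.Properties using (≡-dec)
open import Data.Sum using (_⊎_; inj₁; inj₂; [_,_]′)
open import Function using (_∘_)
open import Function.Bundles using (_↔_; mk↔ₛ′; Inverse; _⇔_; mk⇔)
open import Function.Properties.Bijection using (⤖⇒↔)
open import Function.Properties.Inverse using (↔⇒⤖; ↔-sym; ↔-trans)
open import Function.Definitions using (Injective)
open import Relation.Binary.Structures using (IsTotalPreorder)
open import Relation.Unary using () renaming (Decidable to Decidable₁)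
open import Relation.Binary.Definitions using (Decidable; DecidableEquality; tri<; tri≈; tri>)
open import Relation.Binary.PropositionalEquality
open import Relation.Nullary using (Dec; yes; no; does; ¬_; contradiction)
open import Relation.Nullary.Decidable using (dec-true; dec-false; ¬?; _×-dec_; _⊎-dec_)

𝟙 : Bool → ℕ
𝟙 b = if b then 1 else 0

𝟙≤1 : ∀ b → 𝟙 b ≤ 1
𝟙≤1 true  = ≤-refl
𝟙≤1 false = z≤n

if-yes : ∀ {P : Set} (P? : Dec P) {x} → P → (if does P? then x else 0) ≡ x
if-yes P? {x} p = cong (λ b → if b then x else 0) (dec-true P? p)

if-no : ∀ {P : Set} (P? : Dec P) {x} → ¬ P → (if does P? then x else 0) ≡ 0
if-no P? {x} ¬p = cong (λ b → if b then x else 0) (dec-false P? ¬p)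

𝟙-mono : ∀ {P Q : Set} (P? : Dec P) (Q? : Dec Q) → (P → Q) → 𝟙 (does P?) ≤ 𝟙 (does Q?)
𝟙-mono (yes p) (yes _) _   = ≤-refl
𝟙-mono (yes p) (no ¬q) p⇒q = contradiction (p⇒q p) ¬q
𝟙-mono (no _)  _       _   = z≤n

sumFin≡sum : ∀ G k (f : Fin k → ℕ) → sumFin G k f ≡ sum f
sumFin≡sum G zero    f = refl
sumFin≡sum G (suc k) f = cong (f Fin.zero +_) (sumFin≡sum G k (f ∘ Fin.suc))

sum-zero : ∀ {n} {f : Fin n → ℕ} → (∀ i → f i ≡ 0) → sum f ≡ 0
sum-zero {n} f≗0 = trans (sum-cong-≗ f≗0) (sum-replicate-zero n)

sum-single : ∀ {n} {f : Fin n → ℕ} i → (∀ j → j ≢ i → f j ≡ 0) → sum f ≡ f i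
sum-single {suc n} {f} i f≗0 = begin
  sum f                                  ≡⟨ sum-remove {i = i} f ⟩
  f i + sum (λ j → f (Fin.punchIn i j))  ≡⟨ cong (f i +_) (sum-zero (λ j → f≗0 _ (Finₚ.punchInᵢ≢i i j))) ⟩
  f i + 0                                ≡⟨ +-identityʳ (f i) ⟩
  f i                                    ∎
  where open ≡-Reasoning

∑1≡n : ∀ n → sum {n} (λ _ → 1) ≡ n
∑1≡n zero    = refl
∑1≡n (suc n) = cong suc (∑1≡n n)

sum-mono-≤ : ∀ {n} {f g : Fin n → ℕ} → (∀ i → f i ≤ g i) → sum f ≤ sum g
sum-mono-≤ {zero}  f≤g = z≤n
sum-mono-≤ {suc n} f≤g = +-mono-≤ (f≤g Fin.zero) (sum-mono-≤ (f≤g ∘ Fin.suc))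

sum-mono-< : ∀ {n} {f g : Fin n → ℕ} → (∀ i → f i ≤ g i) → ∀ i → f i < g i → sum f < sum g
sum-mono-< {suc n} f≤g Fin.zero    f<g = +-mono-<-≤ f<g (sum-mono-≤ (f≤g ∘ Fin.suc))
sum-mono-< {suc n} f≤g (Fin.suc i) f<g = +-mono-≤-< (f≤g Fin.zero) (sum-mono-< (f≤g ∘ Fin.suc) i f<g)

pointwise-≤∧sum-≡⇒≗ : ∀ {n} {f g : Fin n → ℕ} → (∀ i → f i ≤ g i) → sum f ≡ sum g → ∀ i → f i ≡ g i
pointwise-≤∧sum-≡⇒≗ f≤g ∑f≡∑g i with m≤n⇒m<n∨m≡n (f≤g i)
... | inj₁ fi<gi = contradiction ∑f≡∑g (<⇒≢ (sum-mono-< f≤g i fi<gi))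
... | inj₂ fi≡gi = fi≡gi

sumUpTo : ℕ → (ℕ → ℕ) → ℕ
sumUpTo k g = sum {k} (λ j → g (toℕ j))

sumUpTo-cong : ∀ k {f g : ℕ → ℕ} → (∀ s → s < k → f s ≡ g s) → sumUpTo k f ≡ sumUpTo k g
sumUpTo-cong k f≗g = sum-cong-≗ {k} (λ j → f≗g (toℕ j) (Finₚ.toℕ<n j))

sumUpTo-+ : ∀ a b g → sumUpTo (a + b) g ≡ sumUpTo a g + sumUpTo b (λ s → g (a + s))
sumUpTo-+ zero    b g = refl
sumUpTo-+ (suc a) b g = trans (cong (g 0 +_) (sumUpTo-+ a b (g ∘ suc))) (sym (+-assoc (g 0) _ _))

sum-δ : ∀ {n} (i : Fin n) (f : Fin n → ℕ) → sum (λ j → if does (j Fin.≟ i) then f j else 0) ≡ f i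
sum-δ i f = trans (sum-single i (λ j → if-no (j Fin.≟ i))) (if-yes (i Fin.≟ i) refl)

[m%d+n]%d≡[m+n]%d : ∀ m n d .{{_ : NonZero d}} → (m % d + n) % d ≡ (m + n) % d
[m%d+n]%d≡[m+n]%d m n d = begin
  (m % d + n) % d          ≡⟨ %-distribˡ-+ (m % d) n d ⟩
  (m % d % d + n % d) % d  ≡⟨ cong (λ x → (x + n % d) % d) (m%n%n≡m%n m d) ⟩
  (m % d + n % d) % d      ≡⟨ %-distribˡ-+ m n d ⟨
  (m + n) % d              ∎
  where open ≡-Reasoning

[m+n%d]%d≡[m+n]%d : ∀ m n d .{{_ : NonZero d}} → (m + n % d) % d ≡ (m + n) % d
[m+n%d]%d≡[m+n]%d m n d =
  trans (cong (_% d) (+-comm m (n % d))) (trans ([m%d+n]%d≡[m+n]%d n m d) (cong (_% d) (+-comm n m)))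

module _ {A : Set} where

  sum-map-tabulate : ∀ {k} (h : A → ℕ) (g : Fin k → A) → List.sum (map h (tabulate g)) ≡ sum (h ∘ g)
  sum-map-tabulate {zero}  h g = refl
  sum-map-tabulate {suc k} h g = cong (h (g Fin.zero) +_) (sum-map-tabulate h (g ∘ Fin.suc))

  sum-map-concatMap-tabulate : ∀ {B : Set} {k} (h : B → ℕ) (F : A → List B) (g : Fin k → A) →
                               List.sum (map h (concatMap F (tabulate g))) ≡ sum (λ i → List.sum (map h (F (g i))))
  sum-map-concatMap-tabulate {k = zero}  h F g = refl
  sum-map-concatMap-tabulate {k = suc k} h F g = begin
    List.sum (map h (F (g Fin.zero) ++ concatMap F (tabulate (g ∘ Fin.suc))))
      ≡⟨ cong List.sum (Listₚ.map-++ h (F (g Fin.zero)) _) ⟩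
    List.sum (map h (F (g Fin.zero)) ++ map h (concatMap F (tabulate (g ∘ Fin.suc))))
      ≡⟨ List.sum-++ (map h (F (g Fin.zero))) _ ⟩
    List.sum (map h (F (g Fin.zero))) + List.sum (map h (concatMap F (tabulate (g ∘ Fin.suc))))
      ≡⟨ cong (List.sum (map h (F (g Fin.zero))) +_) (sum-map-concatMap-tabulate h F (g ∘ Fin.suc)) ⟩
    sum (λ i → List.sum (map h (F (g i))))
      ∎
    where open ≡-Reasoning

  sum-map-↭ : ∀ (h : A → ℕ) {xs ys} → xs ↭ ys → List.sum (map h xs) ≡ List.sum (map h ys)
  sum-map-↭ h xs↭ys = List.sum-↭ (map⁺ h xs↭ys)

  sum-map-filter : ∀ (h : A → ℕ) {P : A → Set} (P? : Decidable₁ P) xs →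
                   List.sum (map h (filter P? xs)) ≡ List.sum (map (λ x → if does (P? x) then h x else 0) xs)
  sum-map-filter h P? []       = refl
  sum-map-filter h P? (x ∷ xs) with does (P? x)
  ... | false = sum-map-filter h P? xs
  ... | true  = cong (h x +_) (sum-map-filter h P? xs)

module _ {A : Set} (_≟_ : DecidableEquality A) where

  multiplicity : A → List A → ℕ
  multiplicity x xs = List.sum (map (λ y → 𝟙 (does (y ≟ x))) xs)

  multiplicity-++ : ∀ x xs ys → multiplicity x (xs ++ ys) ≡ multiplicity x xs + multiplicity x ys
  multiplicity-++ x xs ys = trans (cong List.sum (Listₚ.map-++ _ xs ys)) (List.sum-++ (map (λ y → 𝟙 (does (y ≟ x))) xs) _)

  multiplicity-here : ∀ x xs → multiplicity x (x ∷ xs) ≡ suc (multiplicity x xs)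
  multiplicity-here x xs = cong (_+ multiplicity x xs) (if-yes (x ≟ x) refl)

  multiplicity-map : ∀ {B : Set} x (f : B → A) ys →
                     multiplicity x (map f ys) ≡ List.sum (map (λ y → 𝟙 (does (f y ≟ x))) ys)
  multiplicity-map x f ys = cong List.sum (sym (Listₚ.map-∘ ys))

  multiplicity>0⇒∈ : ∀ {x} ys → 0 < multiplicity x ys → x ∈ ys
  multiplicity>0⇒∈ {x} (y ∷ ys) 0<m with y ≟ x
  ... | yes refl = here refl
  ... | no _     = there (multiplicity>0⇒∈ ys 0<m)

  ↭-by-multiplicity : ∀ xs ys → (∀ x → multiplicity x xs ≡ multiplicity x ys) → xs ↭ ys
  ↭-by-multiplicity []       []       _ = ↭-refl
  ↭-by-multiplicity []       (y ∷ ys) m≡ = contradiction (trans (m≡ y) (multiplicity-here y ys)) 0≢1+n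
  ↭-by-multiplicity (x ∷ xs) ys       m≡
    with ∈-∃++ (multiplicity>0⇒∈ ys (subst (0 <_) (trans (sym (multiplicity-here x xs)) (m≡ x)) z<s))
  ... | ys₁ , ys₂ , refl = ↭-trans (↭-prep x (↭-by-multiplicity xs (ys₁ ++ ys₂) m≡′)) (↭-sym (shift x ys₁ ys₂))
    where
    m≡′ : ∀ z → multiplicity z xs ≡ multiplicity z (ys₁ ++ ys₂)
    m≡′ z = +-cancelˡ-≡ (𝟙 (does (x ≟ z))) _ _ (begin
      𝟙 (does (x ≟ z)) + multiplicity z xs                        ≡⟨ m≡ z ⟩
      multiplicity z (ys₁ ++ x ∷ ys₂)                            ≡⟨ multiplicity-++ z ys₁ (x ∷ ys₂) ⟩
      multiplicity z ys₁ + (𝟙 (does (x ≟ z)) + multiplicity z ys₂) ≡⟨ x∙yz≈y∙xz (multiplicity z ys₁) (𝟙 (does (x ≟ z))) _ ⟩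
      𝟙 (does (x ≟ z)) + (multiplicity z ys₁ + multiplicity z ys₂) ≡⟨ cong (_ +_) (multiplicity-++ z ys₁ ys₂) ⟨
      𝟙 (does (x ≟ z)) + multiplicity z (ys₁ ++ ys₂)              ∎)
      where open ≡-Reasoning

-- Balanced vectors and sums of squares

Balanced : ∀ {n} → (Fin n → ℕ) → Set
Balanced x = ∀ i j → x i ≤ suc (x j)

-- (z − c)(z − c − 1): nonnegative, and zero exactly when z ∈ {c, c + 1}.
excess : ℕ → ℕ → ℕ
excess c z with z ≤? c
... | yes _ = (c ∸ z) * suc (c ∸ z)
... | no  _ = (z ∸ suc c) * suc (z ∸ suc c)

excess-identity : ∀ c z → z ^ 2 + (c * c + c) ≡ excess c z + suc (c + c) * z
excess-identity c z with z ≤? c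
... | yes z≤c = below (c ∸ z) z (sym (m∸n+n≡m z≤c))
  where
  below : ∀ a z → c ≡ a + z → z ^ 2 + (c * c + c) ≡ a * suc a + suc (c + c) * z
  below a z refl = ring a z
    where ring : ∀ a z → z * (z * 1) + ((a + z) * (a + z) + (a + z)) ≡ a * suc a + suc ((a + z) + (a + z)) * z
          ring = solve-∀
... | no z≰c = above (z ∸ suc c) (sym (m∸n+n≡m (≰⇒> z≰c)))
  where
  above : ∀ b → z ≡ b + suc c → z ^ 2 + (c * c + c) ≡ b * suc b + suc (c + c) * z
  above b refl = ring b c
    where ring : ∀ b c → (b + suc c) * ((b + suc c) * 1) + (c * c + c) ≡ b * suc b + suc (c + c) * (b + suc c)
          ring = solve-∀

excess-at : ∀ c → excess c c ≡ 0
excess-at c with c ≤? c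
... | yes _   = cong (λ a → a * suc a) (n∸n≡0 c)
... | no c≰c = contradiction ≤-refl c≰c

excess-at-suc : ∀ c → excess c (suc c) ≡ 0
excess-at-suc c with suc c ≤? c
... | yes c<c = contradiction c<c (n≮n c)
... | no _    = cong (λ a → a * suc a) (n∸n≡0 c)

excess≡0⇒ : ∀ c z → excess c z ≡ 0 → z ≡ c ⊎ z ≡ suc c
excess≡0⇒ c z e with z ≤? c
... | yes z≤c with m*n≡0⇒m≡0∨n≡0 (c ∸ z) e
...   | inj₁ c∸z≡0 = inj₁ (≤-antisym z≤c (m∸n≡0⇒m≤n c∸z≡0))
excess≡0⇒ c z e | no z≰c with m*n≡0⇒m≡0∨n≡0 (z ∸ suc c) e
...   | inj₁ z∸c≡0 = inj₂ (≤-antisym (m∸n≡0⇒m≤n z∸c≡0) (≰⇒> z≰c))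

∑²+const : ∀ {n} c (x : Fin n → ℕ) →
           sum (λ i → x i ^ 2) + sum {n} (λ _ → c * c + c) ≡ sum (λ i → excess c (x i)) + suc (c + c) * sum x
∑²+const {n} c x = begin
  sum (λ i → x i ^ 2) + sum {n} (λ _ → c * c + c)          ≡⟨ ∑-distrib-+ (λ i → x i ^ 2) _ ⟨
  sum (λ i → x i ^ 2 + (c * c + c))                      ≡⟨ sum-cong-≗ (λ i → excess-identity c (x i)) ⟩
  sum (λ i → excess c (x i) + suc (c + c) * x i)          ≡⟨ ∑-distrib-+ (λ i → excess c (x i)) _ ⟩
  sum (λ i → excess c (x i)) + sum (λ i → suc (c + c) * x i) ≡⟨ cong (sum (λ i → excess c (x i)) +_) (*-distribˡ-sum (suc (c + c)) x) ⟨
  sum (λ i → excess c (x i)) + suc (c + c) * sum x        ∎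
  where open ≡-Reasoning

∑²-decomposition : ∀ {n} c (x y : Fin n → ℕ) → (∀ i → y i ≡ c ⊎ y i ≡ suc c) → sum x ≡ sum y →
                   sum (λ i → x i ^ 2) ≡ sum (λ i → excess c (x i)) + sum (λ i → y i ^ 2)
∑²-decomposition {n} c x y y∈ ∑x≡∑y = +-cancelʳ-≡ K _ _ (begin
  sum (λ i → x i ^ 2) + K             ≡⟨ ∑²+const c x ⟩
  E + suc (c + c) * sum x              ≡⟨ cong (λ s → E + suc (c + c) * s) ∑x≡∑y ⟩
  E + suc (c + c) * sum y              ≡⟨ cong (E +_) ∑²y+K ⟨
  E + (sum (λ i → y i ^ 2) + K)       ≡⟨ +-assoc E _ K ⟨
  E + sum (λ i → y i ^ 2) + K         ∎)
  where
  open ≡-Reasoning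
  K = sum {n} (λ _ → c * c + c)
  E = sum (λ i → excess c (x i))
  excess-y : ∀ i → excess c (y i) ≡ 0
  excess-y i with y∈ i
  ... | inj₁ yi≡c  = trans (cong (excess c) yi≡c) (excess-at c)
  ... | inj₂ yi≡1+c = trans (cong (excess c) yi≡1+c) (excess-at-suc c)
  ∑²y+K : sum (λ i → y i ^ 2) + K ≡ suc (c + c) * sum y
  ∑²y+K = trans (∑²+const c y) (cong (_+ suc (c + c) * sum y) (sum-zero excess-y))

∃-argmin : ∀ {n} (y : Fin (suc n) → ℕ) → ∃ λ i → ∀ j → y i ≤ y j
∃-argmin {zero}  y = Fin.zero , λ { Fin.zero → ≤-refl }
∃-argmin {suc n} y with ∃-argmin (y ∘ Fin.suc)
... | i , min with y Fin.zero ≤? y (Fin.suc i)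
...   | yes y₀≤ = Fin.zero , λ { Fin.zero → ≤-refl ; (Fin.suc j) → ≤-trans y₀≤ (min j) }
...   | no y₀≰  = Fin.suc i , λ { Fin.zero → <⇒≤ (≰⇒> y₀≰) ; (Fin.suc j) → min j }

balanced⇒two-valued : ∀ {n} (y : Fin (suc n) → ℕ) → Balanced y → ∃ λ c → ∀ i → y i ≡ c ⊎ y i ≡ suc c
balanced⇒two-valued y bal with ∃-argmin y
... | i₀ , min = y i₀ , λ i → [ (λ lt → inj₂ (≤-antisym (bal i i₀) lt)) , (λ eq → inj₁ (sym eq)) ]′ (m≤n⇒m<n∨m≡n (min i))

balanced⇒∑²-decomposition : ∀ {n} (x y : Fin n → ℕ) → Balanced y → sum x ≡ sum y →
                            ∃ λ c → sum (λ i → x i ^ 2) ≡ sum (λ i → excess c (x i)) + sum (λ i → y i ^ 2)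
balanced⇒∑²-decomposition {zero}  x y _   _       = 0 , refl
balanced⇒∑²-decomposition {suc n} x y bal ∑x≡∑y with balanced⇒two-valued y bal
... | c , y∈ = c , ∑²-decomposition c x y y∈ ∑x≡∑y

balanced-minimises-∑² : ∀ {n} (x y : Fin n → ℕ) → Balanced y → sum x ≡ sum y →
                        sum (λ i → y i ^ 2) ≤ sum (λ i → x i ^ 2)
balanced-minimises-∑² x y bal ∑x≡∑y with balanced⇒∑²-decomposition x y bal ∑x≡∑y
... | c , ∑²x≡ = subst (_ ≤_) (sym ∑²x≡) (m≤n+m _ _)

∣n-1+n∣≡1 : ∀ c → ∣ c - suc c ∣ ≡ 1
∣n-1+n∣≡1 c = trans (m≤n⇒∣m-n∣≡n∸m (n≤1+n c)) (m+n∸n≡m 1 c)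

two-valued⇒∣-∣≤1 : ∀ c a b → (a ≡ c ⊎ a ≡ suc c) → (b ≡ c ⊎ b ≡ suc c) → ∣ a - b ∣ ≤ 1
two-valued⇒∣-∣≤1 c _ _ (inj₁ refl) (inj₁ refl) = ≤-trans (≤-reflexive (∣n-n∣≡0 c)) z≤n
two-valued⇒∣-∣≤1 c _ _ (inj₁ refl) (inj₂ refl) = ≤-reflexive (∣n-1+n∣≡1 c)
two-valued⇒∣-∣≤1 c _ _ (inj₂ refl) (inj₁ refl) = ≤-reflexive (trans (∣-∣-comm (suc c) c) (∣n-1+n∣≡1 c))
two-valued⇒∣-∣≤1 c _ _ (inj₂ refl) (inj₂ refl) = ≤-trans (≤-reflexive (∣n-n∣≡0 (suc c))) z≤n

∣m-n∣≤1⇒m≤1+n : ∀ {m n} → ∣ m - n ∣ ≤ 1 → m ≤ suc n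
∣m-n∣≤1⇒m≤1+n {m} {n} ∣m-n∣≤1 = ≤-trans (m≤n+∣m-n∣ m n) (≤-trans (+-monoʳ-≤ n ∣m-n∣≤1) (≤-reflexive (+-comm n 1)))

∑²-minimal⇒balanced : ∀ {n} (x y : Fin n → ℕ) → Balanced y → sum x ≡ sum y →
                       sum (λ i → y i ^ 2) ≡ sum (λ i → x i ^ 2) → ∀ i j → ∣ x i - x j ∣ ≤ 1
∑²-minimal⇒balanced {n} x y bal ∑x≡∑y ∑²y≡∑²x i j with balanced⇒∑²-decomposition x y bal ∑x≡∑y
... | c , ∑²x≡ = two-valued⇒∣-∣≤1 c (x i) (x j) (x∈ i) (x∈ j)
  where
  ∑excess≡0 : sum (λ i → excess c (x i)) ≡ 0
  ∑excess≡0 = +-cancelʳ-≡ _ _ 0 (trans (sym ∑²x≡) (sym ∑²y≡∑²x))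
  x∈ : ∀ i → x i ≡ c ⊎ x i ≡ suc c
  x∈ i = excess≡0⇒ c (x i) (sym (pointwise-≤∧sum-≡⇒≗ (λ _ → z≤n) (trans (sum-zero {n} {λ _ → 0} (λ _ → refl)) (sym ∑excess≡0)) i))

-- Sorting

Antitone : ∀ {n} → (Fin n → ℕ) → Set
Antitone x = ∀ {i j} → i Fin.< j → x j ≤ x i

antitone-balanced-≤ : ∀ {n} {x y : Fin n → ℕ} → Antitone x → Antitone y → Balanced x → Balanced y →
                      sum x ≡ sum y → ∀ i → x i ≤ y i
antitone-balanced-≤ {x = x} {y} anti-x anti-y bal-x bal-y ∑x≡∑y i with x i ≤? y i
... | yes xi≤yi = xi≤yi
... | no xi≰yi = contradiction (sym ∑x≡∑y) (<⇒≢ (sum-mono-< y≤x i yi<xi))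
  where
  yi<xi : y i < x i
  yi<xi = ≰⇒> xi≰yi
  y≤x : ∀ j → y j ≤ x j
  y≤x j with Finₚ.<-cmp j i
  ... | tri< j<i _ _ = ≤-trans (bal-y j i) (≤-trans yi<xi (anti-x j<i))
  ... | tri≈ _ refl _ = <⇒≤ yi<xi
  ... | tri> _ _ i<j = ≤-trans (anti-y i<j) (≤-pred (≤-trans yi<xi (bal-x i j)))

antitone-balanced-unique : ∀ {n} {x y : Fin n → ℕ} → Antitone x → Antitone y → Balanced x → Balanced y →
                           sum x ≡ sum y → ∀ i → x i ≡ y i
antitone-balanced-unique anti-x anti-y bal-x bal-y ∑x≡∑y i =
  ≤-antisym (antitone-balanced-≤ anti-x anti-y bal-x bal-y ∑x≡∑y i)
            (antitone-balanced-≤ anti-y anti-x bal-y bal-x (sym ∑x≡∑y) i)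

injective⇒surjective : ∀ {n} {f : Fin n → Fin n} → Injective _≡_ _≡_ f → ∀ i → ∃ λ j → f j ≡ i
injective⇒surjective {suc n} {f} f-inj i with Finₚ.any? (λ j → f j Fin.≟ i)
... | yes fj≡i = fj≡i
... | no  i∉im = contradiction (Finₚ.injective⇒≤ punchOut∘f-injective) (n≮n n)
  where
  i≢f : ∀ j → i ≢ f j
  i≢f j i≡fj = i∉im (j , sym i≡fj)
  punchOut∘f-injective : Injective _≡_ _≡_ (λ j → punchOut (i≢f j))
  punchOut∘f-injective = f-inj ∘ Finₚ.punchOut-injective (i≢f _) (i≢f _)

injective⇒permutation : ∀ {n} (f : Fin n → Fin n) → Injective _≡_ _≡_ f → Permutation n n
injective⇒permutation f f-inj =
  permutation f (proj₁ ∘ surj) (proj₂ ∘ surj) (λ j → f-inj (proj₂ (surj (f j))))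
  where surj = injective⇒surjective f-inj

-- Ranks a total preorder decreasingly, ties broken by index: rank j counts the elements strictly above j.
module Ranking {n} {_≲_ : Fin n → Fin n → Set}
               (isTotalPreorder : IsTotalPreorder _≡_ _≲_) (_≲?_ : Decidable _≲_) where
  open IsTotalPreorder isTotalPreorder using (total) renaming (refl to ≲-refl; trans to ≲-trans)

  _≺_ : Fin n → Fin n → Set
  j ≺ k = j ≲ k × (¬ k ≲ j ⊎ k Fin.< j)

  _≺?_ : Decidable _≺_
  j ≺? k = (j ≲? k) ×-dec (¬? (k ≲? j) ⊎-dec (k Fin.<? j))

  ≺-irrefl : ∀ j → ¬ j ≺ j
  ≺-irrefl j (_ , inj₁ j⋦j) = j⋦j ≲-refl
  ≺-irrefl j (_ , inj₂ j<j) = n≮n (toℕ j) j<j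

  ≺-trans : ∀ {i j k} → i ≺ j → j ≺ k → i ≺ k
  ≺-trans (i≲j , inj₁ j⋦i) (j≲k , _)      = ≲-trans i≲j j≲k , inj₁ (λ k≲i → j⋦i (≲-trans j≲k k≲i))
  ≺-trans (i≲j , inj₂ _)   (j≲k , inj₁ k⋦j) = ≲-trans i≲j j≲k , inj₁ (λ k≲i → k⋦j (≲-trans k≲i i≲j))
  ≺-trans (i≲j , inj₂ j<i) (j≲k , inj₂ k<j) = ≲-trans i≲j j≲k , inj₂ (<-trans k<j j<i)

  ≺-trichotomous : ∀ j k → j ≡ k ⊎ j ≺ k ⊎ k ≺ j
  ≺-trichotomous j k with Finₚ.<-cmp j k | j ≲? k | k ≲? j
  ... | tri≈ _ j≡k _ | _ | _ = inj₁ j≡k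
  ... | _ | yes j≲k | no k⋦j = inj₂ (inj₁ (j≲k , inj₁ k⋦j))
  ... | _ | no j⋦k | yes k≲j = inj₂ (inj₂ (k≲j , inj₁ j⋦k))
  ... | _ | no j⋦k | no k⋦j  = [ (λ j≲k → contradiction j≲k j⋦k) , (λ k≲j → contradiction k≲j k⋦j) ]′ (total j k)
  ... | tri< j<k _ _ | yes _ | yes k≲j = inj₂ (inj₂ (k≲j , inj₂ j<k))
  ... | tri> _ _ k<j | yes j≲k | yes _ = inj₂ (inj₁ (j≲k , inj₂ k<j))

  rank : Fin n → ℕ
  rank j = sum (λ k → 𝟙 (does (j ≺? k)))

  rank-< : ∀ {j k} → j ≺ k → rank k < rank j
  rank-< {j} {k} j≺k = sum-mono-< (λ l → 𝟙-mono (k ≺? l) (j ≺? l) (≺-trans j≺k)) k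
    (subst₂ _<_ (sym (if-no (k ≺? k) (≺-irrefl k))) (sym (if-yes (j ≺? k) j≺k)) z<s)

  rank<n : ∀ j → rank j < n
  rank<n j = subst (rank j <_) (∑1≡n n) (sum-mono-< (λ k → 𝟙≤1 (does (j ≺? k))) j
               (subst (_< 1) (sym (if-no (j ≺? j) (≺-irrefl j))) z<s))

  rankᶠ : Fin n → Fin n
  rankᶠ j = fromℕ< (rank<n j)

  rankᶠ-< : ∀ {j k} → j ≺ k → rankᶠ k Fin.< rankᶠ j
  rankᶠ-< {j} {k} j≺k = subst₂ _<_ (sym (Finₚ.toℕ-fromℕ< (rank<n k))) (sym (Finₚ.toℕ-fromℕ< (rank<n j))) (rank-< j≺k)

  rankᶠ-injective : Injective _≡_ _≡_ rankᶠ
  rankᶠ-injective {j} {k} rj≡rk with ≺-trichotomous j k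
  ... | inj₁ j≡k        = j≡k
  ... | inj₂ (inj₁ j≺k) = contradiction (sym rj≡rk) (Finₚ.<⇒≢ (rankᶠ-< j≺k))
  ... | inj₂ (inj₂ k≺j) = contradiction rj≡rk (Finₚ.<⇒≢ (rankᶠ-< k≺j))

  ranking : Permutation n n
  ranking = injective⇒permutation rankᶠ rankᶠ-injective

  ranking-antitone : ∀ j k → ranking ⟨$⟩ʳ j Fin.< ranking ⟨$⟩ʳ k → k ≲ j
  ranking-antitone j k rj<rk with ≺-trichotomous j k
  ... | inj₁ refl       = contradiction rj<rk (n≮n _)
  ... | inj₂ (inj₁ j≺k) = contradiction rj<rk (<-asym (rankᶠ-< j≺k))
  ... | inj₂ (inj₂ k≺j) = proj₁ k≺j

-- Counters

-- Over every window [t, t'] of [0, N], the counter x gains at most one on the counter y.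
GainsAtMostOne : ℕ → (ℕ → ℕ) → (ℕ → ℕ) → Set
GainsAtMostOne N x y = ∀ {t t'} → t ≤ t' → t' ≤ N → x t' + y t ≤ suc (y t' + x t)

increments⇒gains : ∀ N {x y : ℕ → ℕ} →
                   (∀ {t t′} → t ≤ t′ → t′ ≤ N → ∃ λ u → ∃ λ w → x t′ ≡ x t + u × y t′ ≡ y t + w × u ≤ suc w) →
                   GainsAtMostOne N x y
increments⇒gains N {x} {y} increments {t} {t′} t≤t′ t′≤N with increments t≤t′ t′≤N
... | u , w , x-inc , y-inc , u≤1+w = begin
  x t′ + y t             ≡⟨ cong (_+ y t) x-inc ⟩
  x t + u + y t          ≡⟨ rearrange (x t) u (y t) ⟩
  u + (y t + x t)        ≤⟨ +-monoˡ-≤ (y t + x t) u≤1+w ⟩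
  suc (w + (y t + x t))  ≡⟨ cong suc (rearrange′ (y t) w (x t)) ⟨
  suc (y t + w + x t)    ≡⟨ cong (λ z → suc (z + x t)) y-inc ⟨
  suc (y t′ + x t)       ∎
  where
  open ≤-Reasoning
  rearrange : ∀ a b c → a + b + c ≡ b + (c + a)
  rearrange = solve-∀
  rearrange′ : ∀ a b c → a + b + c ≡ b + (a + c)
  rearrange′ = solve-∀

m<n∧o<p⇒n+p≰1+m+o : ∀ {a b c d} → a < b → c < d → ¬ b + d ≤ suc (a + c)
m<n∧o<p⇒n+p≰1+m+o {a} {b} {c} {d} a<b c<d b+d≤ = n≮n (suc (a + c))
  (≤-trans (≤-reflexive (sym (cong suc (+-suc a c)))) (≤-trans (+-mono-≤ a<b c<d) b+d≤))

counters-never-cross : ∀ N (x y : ℕ → ℕ) → GainsAtMostOne N x y → GainsAtMostOne N y x →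
                       (∀ t → t ≤ N → y t ≤ x t) ⊎ (∀ t → t ≤ N → x t ≤ y t)
counters-never-cross N x y x-gain y-gain with anyUpTo? (λ t → x t <? y t) (suc N)
... | no ¬x<y = inj₁ (λ t t≤N → ≮⇒≥ (λ x<y → ¬x<y (t , s≤s t≤N , x<y)))
... | yes (t₁ , s≤s t₁≤N , x<y) = inj₂ (λ t t≤N → ≮⇒≥ (λ y<x → crossed t t≤N y<x))
  where
  crossed : ∀ t → t ≤ N → y t < x t → ⊥
  crossed t t≤N y<x with ≤-total t₁ t
  ... | inj₁ t₁≤t = m<n∧o<p⇒n+p≰1+m+o y<x x<y (x-gain t₁≤t t≤N)
  ... | inj₂ t≤t₁ = m<n∧o<p⇒n+p≰1+m+o x<y y<x (y-gain t≤t₁ t₁≤N)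

module _ {d} (N : ℕ) (f : Fin d → ℕ → ℕ) (gains : ∀ j k → GainsAtMostOne N (f j) (f k)) where

  gains⇒balanced : (∀ j → f j 0 ≡ 0) → ∀ t → t ≤ N → Balanced (λ j → f j t)
  gains⇒balanced f₀≡0 t t≤N j k = subst₂ (λ a b → a ≤ suc b)
    (trans (cong (f j t +_) (f₀≡0 k)) (+-identityʳ _)) (trans (cong (f k t +_) (f₀≡0 j)) (+-identityʳ _))
    (gains j k z≤n t≤N)

  private
    _≲_ : Fin d → Fin d → Set
    j ≲ k = ∀ {t} → t < suc N → f j t ≤ f k t

    ≲-total : ∀ j k → j ≲ k ⊎ k ≲ j
    ≲-total j k with counters-never-cross N (f j) (f k) (gains j k) (gains k j)
    ... | inj₁ k≤j = inj₂ (λ t<1+N → k≤j _ (≤-pred t<1+N))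
    ... | inj₂ j≤k = inj₁ (λ t<1+N → j≤k _ (≤-pred t<1+N))

    ≲-isTotalPreorder : IsTotalPreorder _≡_ _≲_
    ≲-isTotalPreorder = record
      { isPreorder = record
        { isEquivalence = isEquivalence
        ; reflexive     = λ { refl _ → ≤-refl }
        ; trans         = λ j≲k k≲l t<1+N → ≤-trans (j≲k t<1+N) (k≲l t<1+N)
        }
      ; total = ≲-total
      }

  sorting-permutation : Σ (Permutation d d) λ π → ∀ t → t ≤ N → Antitone (λ ρ → f (π ⟨$⟩ˡ ρ) t)
  sorting-permutation = ranking , λ t t≤N {ρ} {ρ′} ρ<ρ′ →
      ranking-antitone (ranking ⟨$⟩ˡ ρ) (ranking ⟨$⟩ˡ ρ′)
        (subst₂ Fin._<_ (sym (inverseʳ ranking)) (sym (inverseʳ ranking)) ρ<ρ′) (s≤s t≤N)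
    where open Ranking ≲-isTotalPreorder (λ j k → allUpTo? (λ t → f j t ≤? f k t) (suc N))

sorted-matching : ∀ {d} N (a b : Fin d → ℕ → ℕ) (πa πb : Permutation d d) →
  (∀ t → t ≤ N → Antitone (λ ρ → a (πa ⟨$⟩ˡ ρ) t)) → (∀ t → t ≤ N → Antitone (λ ρ → b (πb ⟨$⟩ˡ ρ) t)) →
  (∀ t → t ≤ N → Balanced (λ j → a j t)) → (∀ t → t ≤ N → Balanced (λ j → b j t)) →
  (∀ t → t ≤ N → sum (λ j → a j t) ≡ sum (λ j → b j t)) →
  ∀ j t → t ≤ N → a j t ≡ b (πb ⟨$⟩ˡ (πa ⟨$⟩ʳ j)) t
sorted-matching N a b πa πb a-antitone b-antitone a-balanced b-balanced ∑a≡∑b j t t≤N =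
  trans (cong (λ i → a i t) (sym (inverseˡ πa))) (antitone-balanced-unique (a-antitone t t≤N) (b-antitone t t≤N)
    (λ ρ ρ′ → a-balanced t t≤N _ _) (λ ρ ρ′ → b-balanced t t≤N _ _)
    (trans (sym (∑-permute (λ j → a j t) (flip πa))) (trans (∑a≡∑b t t≤N) (∑-permute (λ j → b j t) (flip πb))))
    (πa ⟨$⟩ʳ j))

counters-matching : ∀ {d} N (a b : Fin d → ℕ → ℕ) →
  (∀ j k → GainsAtMostOne N (a j) (a k)) → (∀ j k → GainsAtMostOne N (b j) (b k)) →
  (∀ j → a j 0 ≡ 0) → (∀ j → b j 0 ≡ 0) → (∀ t → t ≤ N → sum (λ j → a j t) ≡ sum (λ j → b j t)) →
  Σ (Permutation d d) λ σ → ∀ j t → t ≤ N → a j t ≡ b (σ ⟨$⟩ʳ j) t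
counters-matching N a b a-gains b-gains a₀≡0 b₀≡0 ∑a≡∑b = πa ∘ₚ flip πb ,
  sorted-matching N a b πa πb (proj₂ (sorting-permutation N a a-gains)) (proj₂ (sorting-permutation N b b-gains))
    (gains⇒balanced N a a-gains a₀≡0) (gains⇒balanced N b b-gains b₀≡0) ∑a≡∑b
  where
  πa = proj₁ (sorting-permutation N a a-gains)
  πb = proj₁ (sorting-permutation N b b-gains)

module _ (G : Graph) where
  open Graph G

  -- Rotor emission

  emit-+ : ∀ {d} (p : Fin d) a b j → emit G p (a + b) j ≡ emit G p a j + emit G (advance G p a) b j
  emit-+ p zero    b j = refl
  emit-+ p (suc a) b j = trans (cong (𝟙 (does (j Fin.≟ p)) +_) (emit-+ (next p) a b j)) (sym (+-assoc (𝟙 (does (j Fin.≟ p))) _ _))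

  ∑-emit : ∀ {d} (p : Fin d) k → sum (emit G p k) ≡ k
  ∑-emit {d} p zero = sum-zero {d} {λ _ → 0} (λ _ → refl)
  ∑-emit p (suc k) = trans (∑-distrib-+ (λ j → 𝟙 (does (j Fin.≟ p))) _) (cong₂ _+_ (sum-δ p (λ _ → 1)) (∑-emit (next p) k))

  toℕ-advance : ∀ {d} (p : Fin (suc d)) s → toℕ (advance G p s) ≡ (toℕ p + s) % suc d
  toℕ-advance {d} p zero = sym (trans (cong (_% suc d) (+-identityʳ (toℕ p))) (m<n⇒m%n≡m (Finₚ.toℕ<n p)))
  toℕ-advance {d} p (suc s) = begin
    toℕ (advance G (next p) s)          ≡⟨ toℕ-advance (next p) s ⟩
    (toℕ (next p) + s) % suc d           ≡⟨ cong (λ x → (x + s) % suc d) (Finₚ.toℕ-fromℕ< (m%n<n (suc (toℕ p)) (suc d))) ⟩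
    (suc (toℕ p) % suc d + s) % suc d    ≡⟨ [m%d+n]%d≡[m+n]%d (suc (toℕ p)) s (suc d) ⟩
    (suc (toℕ p) + s) % suc d            ≡⟨ cong (_% suc d) (+-suc (toℕ p) s) ⟨
    (toℕ p + suc s) % suc d              ∎
    where open ≡-Reasoning

  advance-period : ∀ {d} (p : Fin d) → advance G p d ≡ p
  advance-period {suc d} p = Finₚ.toℕ-injective (begin
    toℕ (advance G p (suc d)) ≡⟨ toℕ-advance p (suc d) ⟩
    (toℕ p + suc d) % suc d   ≡⟨ [m+n]%n≡m%n (toℕ p) (suc d) ⟩
    toℕ p % suc d             ≡⟨ m<n⇒m%n≡m (Finₚ.toℕ<n p) ⟩
    toℕ p                     ∎)
    where open ≡-Reasoning

  -- The pointer reaches j after (j − p) mod d steps.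
  advance-reaches : ∀ {d} (p j : Fin d) → ∃ λ s → s < d × advance G p s ≡ j
  advance-reaches {suc d} p j = s , m%n<n (toℕ j + (suc d ∸ toℕ p)) (suc d) , Finₚ.toℕ-injective (begin
    toℕ (advance G p s)                               ≡⟨ toℕ-advance p s ⟩
    (toℕ p + s) % suc d                               ≡⟨ [m+n%d]%d≡[m+n]%d (toℕ p) _ (suc d) ⟩
    (toℕ p + (toℕ j + (suc d ∸ toℕ p))) % suc d       ≡⟨ cong (_% suc d) (x∙yz≈y∙xz (toℕ p) (toℕ j) _) ⟩
    (toℕ j + (toℕ p + (suc d ∸ toℕ p))) % suc d       ≡⟨ cong (λ x → (toℕ j + x) % suc d) (m+[n∸m]≡n (<⇒≤ (Finₚ.toℕ<n p))) ⟩
    (toℕ j + suc d) % suc d                           ≡⟨ [m+n]%n≡m%n (toℕ j) (suc d) ⟩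
    toℕ j % suc d                                     ≡⟨ m<n⇒m%n≡m (Finₚ.toℕ<n j) ⟩
    toℕ j                                             ∎)
    where
    open ≡-Reasoning
    s = (toℕ j + (suc d ∸ toℕ p)) % suc d

  emit-period : ∀ {d} (p : Fin d) j → emit G p d j ≡ 1
  emit-period {d} p j = sym (pointwise-≤∧sum-≡⇒≗ 1≤emit (trans (∑1≡n d) (sym (∑-emit p d))) j)
    where
    1≤emit : ∀ j → 1 ≤ emit G p d j
    1≤emit j with advance-reaches p j
    ... | s , s<d , reach-j = subst (λ k → 1 ≤ emit G p k j) (trans (+-suc s _) (m+[n∸m]≡n s<d)) (begin
      1                                                  ≡⟨ if-yes (j Fin.≟ j) refl ⟨
      𝟙 (does (j Fin.≟ j))                               ≤⟨ m≤m+n _ _ ⟩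
      emit G j (suc (d ∸ suc s)) j                       ≡⟨ cong (λ q → emit G q (suc (d ∸ suc s)) j) reach-j ⟨
      emit G (advance G p s) (suc (d ∸ suc s)) j         ≤⟨ m≤n+m _ (emit G p s j) ⟩
      emit G p s j + emit G (advance G p s) (suc (d ∸ suc s)) j ≡⟨ emit-+ p s _ j ⟨
      emit G p (s + suc (d ∸ suc s)) j                   ∎)
      where open ≤-Reasoning

  emit-≤1 : ∀ {d} (p : Fin d) {k} j → k ≤ d → emit G p k j ≤ 1
  emit-≤1 {d} p {k} j k≤d = begin
    emit G p k j                                   ≤⟨ m≤m+n _ _ ⟩
    emit G p k j + emit G (advance G p k) (d ∸ k) j ≡⟨ emit-+ p k (d ∸ k) j ⟨
    emit G p (k + (d ∸ k)) j                       ≡⟨ cong (λ k → emit G p k j) (m+[n∸m]≡n k≤d) ⟩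
    emit G p d j                                   ≡⟨ emit-period p j ⟩
    1                                              ∎
    where open ≤-Reasoning

  emit-+-periods : ∀ {d} (p : Fin d) r q j → emit G p (r + q * d) j ≡ q + emit G p r j
  emit-+-periods {d} p r zero    j = cong (λ k → emit G p k j) (+-identityʳ r)
  emit-+-periods {d} p r (suc q) j = begin
    emit G p (r + (d + q * d)) j                        ≡⟨ cong (λ k → emit G p k j) (x∙yz≈y∙xz r d (q * d)) ⟩
    emit G p (d + (r + q * d)) j                        ≡⟨ emit-+ p d _ j ⟩
    emit G p d j + emit G (advance G p d) (r + q * d) j  ≡⟨ cong₂ _+_ (emit-period p j) (cong (λ p → emit G p (r + q * d) j) (advance-period p)) ⟩
    suc (emit G p (r + q * d) j)                        ≡⟨ cong suc (emit-+-periods p r q j) ⟩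
    suc (q + emit G p r j)                              ∎
    where open ≡-Reasoning

  -- Writing k = r + q d with r < d, every arc receives q or q + 1 tokens.
  emit-balanced : ∀ {d} (p : Fin d) k → Balanced (emit G p k)
  emit-balanced {suc d} p k j j′ = subst (λ k → emit G p k j ≤ suc (emit G p k j′)) (sym (m≡m%n+[m/n]*n k (suc d))) (begin
    emit G p (r + q * suc d) j      ≡⟨ emit-+-periods p r q j ⟩
    q + emit G p r j                ≤⟨ +-monoʳ-≤ q (emit-≤1 p j (<⇒≤ (m%n<n k (suc d)))) ⟩
    q + 1                           ≡⟨ +-comm q 1 ⟩
    suc q                           ≤⟨ s≤s (m≤m+n q _) ⟩
    suc (q + emit G p r j′)         ≡⟨ cong suc (emit-+-periods p r q j′) ⟨
    suc (emit G p (r + q * suc d) j′) ∎)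
    where
    open ≤-Reasoning
    r = k % suc d
    q = k / suc d

  emit-accumulate : ∀ {d} k (p : ℕ → Fin d) (T : ℕ → ℕ) j → (∀ s → p (suc s) ≡ advance G (p s) (T s)) →
                    sumUpTo k (λ s → emit G (p s) (T s) j) ≡ emit G (p 0) (sumUpTo k T) j
  emit-accumulate zero    p T j p-step = refl
  emit-accumulate (suc k) p T j p-step = begin
    emit G (p 0) (T 0) j + sumUpTo k (λ s → emit G (p (suc s)) (T (suc s)) j)
      ≡⟨ cong (emit G (p 0) (T 0) j +_) (emit-accumulate k (p ∘ suc) (T ∘ suc) j (p-step ∘ suc)) ⟩
    emit G (p 0) (T 0) j + emit G (p 1) (sumUpTo k (T ∘ suc)) j
      ≡⟨ cong (λ q → emit G (p 0) (T 0) j + emit G q (sumUpTo k (T ∘ suc)) j) (p-step 0) ⟩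
    emit G (p 0) (T 0) j + emit G (advance G (p 0) (T 0)) (sumUpTo k (T ∘ suc)) j
      ≡⟨ emit-+ (p 0) (T 0) _ j ⟨
    emit G (p 0) (T 0 + sumUpTo k (T ∘ suc)) j
      ∎
    where open ≡-Reasoning

  _≟ᴬ_ : DecidableEquality (Arc G)
  _≟ᴬ_ = ≡-dec Fin._≟_ Fin._≟_

  ∑ᴬ : (Arc G → ℕ) → ℕ
  ∑ᴬ h = sum (λ v → sum (λ i → h (v , i)))

  sumArcs≡∑ᴬ : ∀ h → sumArcs G h ≡ ∑ᴬ h
  sumArcs≡∑ᴬ h = trans (sumFin≡sum G n _) (sum-cong-≗ (λ v → sumFin≡sum G (deg v) _))

  ∑ᴬ-cong : ∀ {f g : Arc G → ℕ} → (∀ e → f e ≡ g e) → ∑ᴬ f ≡ ∑ᴬ g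
  ∑ᴬ-cong f≗g = sum-cong-≗ (λ v → sum-cong-≗ (λ i → f≗g (v , i)))

  ∑ᴬ-comm : ∀ {k} (f : Arc G → Fin k → ℕ) → ∑ᴬ (λ e → sum (f e)) ≡ sum (λ j → ∑ᴬ (λ e → f e j))
  ∑ᴬ-comm f = trans (sum-cong-≗ (λ v → ∑-comm (λ i → f (v , i)))) (∑-comm (λ v j → sum (λ i → f (v , i) j)))

  ∑ᴬ-δ : ∀ (h : Arc G → ℕ) a → ∑ᴬ (λ e → if does (e ≟ᴬ a) then h e else 0) ≡ h a
  ∑ᴬ-δ h (v₀ , i₀) = begin
    ∑ᴬ (λ e → if does (e ≟ᴬ (v₀ , i₀)) then h e else 0)            ≡⟨ sum-single v₀ (λ v v≢v₀ → sum-zero (λ i → if-no ((v , i) ≟ᴬ _) (v≢v₀ ∘ cong proj₁))) ⟩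
    sum (λ i → if does ((v₀ , i) ≟ᴬ (v₀ , i₀)) then h (v₀ , i) else 0) ≡⟨ sum-single i₀ (λ i i≢i₀ → if-no ((v₀ , i) ≟ᴬ _) λ { refl → i≢i₀ refl }) ⟩
    (if does ((v₀ , i₀) ≟ᴬ (v₀ , i₀)) then h (v₀ , i₀) else 0)     ≡⟨ if-yes ((v₀ , i₀) ≟ᴬ _) refl ⟩
    h (v₀ , i₀)                                                    ∎
    where open ≡-Reasoning

  -- The j-th incoming arc of w is the reverse of its j-th outgoing arc.
  reverse : (w : Fin n) → Fin (deg w) → Arc G
  reverse w j = nbr w j , proj₁ (symmetric w j)

  head-reverse : ∀ w j → head G (reverse w j) ≡ w
  head-reverse w j = proj₂ (symmetric w j)

  reverse-injective : ∀ w {j j′} → reverse w j ≡ reverse w j′ → j ≡ j′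
  reverse-injective w {j} {j′} eq = noMulti w j j′ (cong proj₁ eq)

  arc-≡ : ∀ {u u′} (i : Fin (deg u)) (i′ : Fin (deg u′)) → u ≡ u′ → head G (u , i) ≡ head G (u′ , i′) →
          _≡_ {A = Arc G} (u , i) (u′ , i′)
  arc-≡ {u} i i′ refl same-head = cong (u ,_) (noMulti u i i′ same-head)

  reverse-surjective : ∀ w e → head G e ≡ w → ∃ λ j → reverse w j ≡ e
  reverse-surjective .(nbr u i) (u , i) refl = j , arc-≡ _ i (proj₂ (symmetric u i)) (head-reverse (nbr u i) j)
    where j = proj₁ (symmetric u i)

  ∑ᴬ-into : ∀ w (h : Arc G → ℕ) →
            ∑ᴬ (λ e → if does (head G e Fin.≟ w) then h e else 0) ≡ sum (λ j → h (reverse w j))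
  ∑ᴬ-into w h = begin
    ∑ᴬ (λ e → if does (head G e Fin.≟ w) then h e else 0)            ≡⟨ ∑ᴬ-cong into-w-as-δ ⟩
    ∑ᴬ (λ e → sum (λ j → if does (e ≟ᴬ reverse w j) then h e else 0)) ≡⟨ ∑ᴬ-comm (λ e j → if does (e ≟ᴬ reverse w j) then h e else 0) ⟩
    sum (λ j → ∑ᴬ (λ e → if does (e ≟ᴬ reverse w j) then h e else 0)) ≡⟨ sum-cong-≗ (λ j → ∑ᴬ-δ h (reverse w j)) ⟩
    sum (λ j → h (reverse w j))                                      ∎
    where
    open ≡-Reasoning
    into-w-as-δ : ∀ e → (if does (head G e Fin.≟ w) then h e else 0) ≡ sum (λ j → if does (e ≟ᴬ reverse w j) then h e else 0)
    into-w-as-δ e with head G e Fin.≟ w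
    ... | no e↛w = sym (sum-zero (λ j → if-no (e ≟ᴬ reverse w j) (λ e≡ → e↛w (trans (cong (head G) e≡) (head-reverse w j)))))
    ... | yes e↦w with reverse-surjective w e e↦w
    ...   | j₀ , rev-j₀≡e = sym (trans (sum-single j₀ off-j₀) (if-yes (e ≟ᴬ reverse w j₀) (sym rev-j₀≡e)))
      where
      off-j₀ : ∀ j → j ≢ j₀ → (if does (e ≟ᴬ reverse w j) then h e else 0) ≡ 0
      off-j₀ j j≢j₀ = if-no (e ≟ᴬ reverse w j) (λ e≡ → j≢j₀ (reverse-injective w (trans (sym e≡) (sym rev-j₀≡e))))

  ∑ᴬ-by-head : ∀ h → ∑ᴬ h ≡ sum (λ w → sum (λ j → h (reverse w j)))
  ∑ᴬ-by-head h = begin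
    ∑ᴬ h                                                              ≡⟨ ∑ᴬ-cong (λ e → sym (head-δ e)) ⟩
    ∑ᴬ (λ e → sum (λ w → if does (head G e Fin.≟ w) then h e else 0)) ≡⟨ ∑ᴬ-comm (λ e w → if does (head G e Fin.≟ w) then h e else 0) ⟩
    sum (λ w → ∑ᴬ (λ e → if does (head G e Fin.≟ w) then h e else 0)) ≡⟨ sum-cong-≗ (λ w → ∑ᴬ-into w h) ⟩
    sum (λ w → sum (λ j → h (reverse w j)))                          ∎
    where
    open ≡-Reasoning
    head-δ : ∀ e → sum (λ w → if does (head G e Fin.≟ w) then h e else 0) ≡ h e
    head-δ e = trans (sum-single (head G e) (λ w w≢ → if-no (head G e Fin.≟ w) (w≢ ∘ sym))) (if-yes (head G e Fin.≟ head G e) refl)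

  reverseIn : ∀ w → Fin (deg w) → InArc G w
  reverseIn w j = nbr w j , proj₁ (symmetric w j) , proj₂ (symmetric w j)

  inArc-injective : ∀ {v} {e e′ : InArc G v} → inArc G e ≡ inArc G e′ → e ≡ e′
  inArc-injective {e = u , i , refl} {.u , .i , refl} refl = refl

  reverseIn-↔ : ∀ w → Fin (deg w) ↔ InArc G w
  reverseIn-↔ w = mk↔ₛ′ (reverseIn w) index reverseIn-index index-reverseIn
    where
    index : InArc G w → Fin (deg w)
    index (u , i , u↦w) = proj₁ (reverse-surjective w (u , i) u↦w)
    reverseIn-index : ∀ e → reverseIn w (index e) ≡ e
    reverseIn-index (u , i , u↦w) = inArc-injective (proj₂ (reverse-surjective w (u , i) u↦w))
    index-reverseIn : ∀ j → index (reverseIn w j) ≡ j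
    index-reverseIn j = reverse-injective w (proj₂ (reverse-surjective w (reverse w j) (head-reverse w j)))

  sum-outList : ∀ h v → List.sum (map h (outList G v)) ≡ sum (λ i → h (v , i))
  sum-outList h v = trans (cong (List.sum ∘ map h) (Listₚ.map-tabulate (λ i → i) (v ,_))) (sum-map-tabulate h (v ,_))

  sum-allArcs : ∀ h → List.sum (map h (allArcs G)) ≡ ∑ᴬ h
  sum-allArcs h = trans (sum-map-concatMap-tabulate h (outList G) (λ v → v)) (sum-cong-≗ (sum-outList h))

  sum-inList : ∀ h v → List.sum (map h (inList G v)) ≡ sum (λ j → h (reverse v j))
  sum-inList h v = trans (sum-map-filter h (λ e → head G e Fin.≟ v) (allArcs G)) (trans (sum-allArcs (λ e → if does (head G e Fin.≟ v) then h e else 0)) (∑ᴬ-into v h))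

  -- Window counts

  pointerAt : State G → ℕ → (v : Fin n) → Fin (deg v)
  pointerAt S t = State.pointer (stateAt G S t)

  tokensAt : State G → ℕ → Fin n → ℕ
  tokensAt S t = State.tokens (stateAt G S t)

  stateAt-+ : ∀ S s t → stateAt G (stateAt G S s) t ≡ stateAt G S (t + s)
  stateAt-+ S s zero    = refl
  stateAt-+ S s (suc t) = cong (step G) (stateAt-+ S s t)

  C≡sumUpTo : ∀ S t₁ t₂ e → C G S t₁ t₂ e ≡ sumUpTo (t₂ ∸ t₁) (λ s → L G S (t₁ + s) e)
  C≡sumUpTo S t₁ t₂ e = sumFin≡sum G (t₂ ∸ t₁) _

  C-+ : ∀ S {t₁ t₂ t₃} e → t₁ ≤ t₂ → t₂ ≤ t₃ → C G S t₁ t₃ e ≡ C G S t₁ t₂ e + C G S t₂ t₃ e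
  C-+ S {t₁} {t₂} {t₃} e t₁≤t₂ t₂≤t₃ = begin
    C G S t₁ t₃ e                                              ≡⟨ C≡sumUpTo S t₁ t₃ e ⟩
    sumUpTo (t₃ ∸ t₁) L₁                                       ≡⟨ cong (λ k → sumUpTo k L₁) t₃∸t₁≡ ⟩
    sumUpTo ((t₂ ∸ t₁) + (t₃ ∸ t₂)) L₁                         ≡⟨ sumUpTo-+ (t₂ ∸ t₁) (t₃ ∸ t₂) L₁ ⟩
    sumUpTo (t₂ ∸ t₁) L₁ + sumUpTo (t₃ ∸ t₂) (λ s → L₁ ((t₂ ∸ t₁) + s))
      ≡⟨ cong (sumUpTo (t₂ ∸ t₁) L₁ +_) (sumUpTo-cong (t₃ ∸ t₂) (λ s _ → cong (λ t → L G S t e) (t₁+[t₂∸t₁+s]≡t₂+s s))) ⟩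
    sumUpTo (t₂ ∸ t₁) L₁ + sumUpTo (t₃ ∸ t₂) (λ s → L G S (t₂ + s) e) ≡⟨ cong₂ _+_ (C≡sumUpTo S t₁ t₂ e) (C≡sumUpTo S t₂ t₃ e) ⟨
    C G S t₁ t₂ e + C G S t₂ t₃ e                              ∎
    where
    open ≡-Reasoning
    L₁ = λ s → L G S (t₁ + s) e
    t₃∸t₁≡ : t₃ ∸ t₁ ≡ (t₂ ∸ t₁) + (t₃ ∸ t₂)
    t₃∸t₁≡ = trans (cong (_∸ t₁) (sym (m+[n∸m]≡n t₂≤t₃))) (+-∸-comm (t₃ ∸ t₂) t₁≤t₂)
    t₁+[t₂∸t₁+s]≡t₂+s : ∀ s → t₁ + ((t₂ ∸ t₁) + s) ≡ t₂ + s
    t₁+[t₂∸t₁+s]≡t₂+s s = trans (sym (+-assoc t₁ (t₂ ∸ t₁) s)) (cong (_+ s) (m+[n∸m]≡n t₁≤t₂))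

  C-single : ∀ S t e → C G S t (suc t) e ≡ L G S t e
  C-single S t e = begin
    C G S t (suc t) e                                   ≡⟨ C≡sumUpTo S t (suc t) e ⟩
    sumUpTo (suc t ∸ t) (λ s → L G S (t + s) e)          ≡⟨ cong (λ k → sumUpTo k (λ s → L G S (t + s) e)) (m+n∸n≡m 1 t) ⟩
    L G S (t + 0) e + 0                                 ≡⟨ +-identityʳ _ ⟩
    L G S (t + 0) e                                     ≡⟨ cong (λ t → L G S t e) (+-identityʳ t) ⟩
    L G S t e                                           ∎
    where open ≡-Reasoning

  C-stateAt : ∀ S s i e → C G (stateAt G S s) 0 i e ≡ C G S s (s + i) e
  C-stateAt S s i e = begin
    C G (stateAt G S s) 0 i e                           ≡⟨ C≡sumUpTo (stateAt G S s) 0 i e ⟩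
    sumUpTo i (λ r → load G (stateAt G (stateAt G S s) r) e) ≡⟨ sumUpTo-cong i (λ r _ → cong (λ X → load G X e) (stateAt-+ S s r)) ⟩
    sumUpTo i (λ r → L G S (r + s) e)                   ≡⟨ sumUpTo-cong i (λ r _ → cong (λ t → L G S t e) (+-comm r s)) ⟩
    sumUpTo i (λ r → L G S (s + r) e)                   ≡⟨ cong (λ k → sumUpTo k (λ r → L G S (s + r) e)) (m+n∸m≡n s i) ⟨
    sumUpTo (s + i ∸ s) (λ r → L G S (s + r) e)         ≡⟨ C≡sumUpTo S s (s + i) e ⟨
    C G S s (s + i) e                                   ∎
    where open ≡-Reasoning

  C-out : ∀ S t₁ t₂ v i →
          C G S t₁ t₂ (v , i) ≡ emit G (pointerAt S t₁ v) (sumUpTo (t₂ ∸ t₁) (λ s → tokensAt S (t₁ + s) v)) i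
  C-out S t₁ t₂ v i = begin
    C G S t₁ t₂ (v , i)                         ≡⟨ C≡sumUpTo S t₁ t₂ (v , i) ⟩
    sumUpTo (t₂ ∸ t₁) (λ s → emit G (pointerAt S (t₁ + s) v) (tokensAt S (t₁ + s) v) i)
      ≡⟨ emit-accumulate (t₂ ∸ t₁) (λ s → pointerAt S (t₁ + s) v) (λ s → tokensAt S (t₁ + s) v) i
                         (λ s → cong (λ t → pointerAt S t v) (+-suc t₁ s)) ⟩
    emit G (pointerAt S (t₁ + 0) v) tokens i    ≡⟨ cong (λ t → emit G (pointerAt S t v) tokens i) (+-identityʳ t₁) ⟩
    emit G (pointerAt S t₁ v) tokens i          ∎
    where
    open ≡-Reasoning
    tokens = sumUpTo (t₂ ∸ t₁) (λ s → tokensAt S (t₁ + s) v)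

  tokensAt-suc : ∀ S t w → tokensAt S (suc t) w ≡ sum (λ j → L G S t (reverse w j))
  tokensAt-suc S t w = trans (sumArcs≡∑ᴬ _) (∑ᴬ-into w (load G (stateAt G S t)))

  C-out-suc : ∀ S t t′ v m →
              C G S (suc t) (suc t′) (v , m) ≡ emit G (pointerAt S (suc t) v) (sum (λ j → C G S t t′ (reverse v j))) m
  C-out-suc S t t′ v m = trans (C-out S (suc t) (suc t′) v m) (cong (λ k → emit G (pointerAt S (suc t) v) k m) (begin
    sumUpTo (t′ ∸ t) (λ s → tokensAt S (suc (t + s)) v)                  ≡⟨ sumUpTo-cong (t′ ∸ t) (λ s _ → tokensAt-suc S (t + s) v) ⟩
    sumUpTo (t′ ∸ t) (λ s → sum (λ j → L G S (t + s) (reverse v j)))      ≡⟨ ∑-comm {t′ ∸ t} (λ s j → L G S (t + toℕ s) (reverse v j)) ⟩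
    sum (λ j → sumUpTo (t′ ∸ t) (λ s → L G S (t + s) (reverse v j)))      ≡⟨ sum-cong-≗ (λ j → C≡sumUpTo S t t′ (reverse v j)) ⟨
    sum (λ j → C G S t t′ (reverse v j))                                 ∎))
    where open ≡-Reasoning

  flow-conservation : ∀ S t t′ v → sum (λ m → C G S (suc t) (suc t′) (v , m)) ≡ sum (λ j → C G S t t′ (reverse v j))
  flow-conservation S t t′ v = trans (sum-cong-≗ (C-out-suc S t t′ v)) (∑-emit (pointerAt S (suc t) v) _)

  C-out-balanced : ∀ S t t′ v → Balanced (λ m → C G S (suc t) (suc t′) (v , m))
  C-out-balanced S t t′ v m m′ = subst₂ (λ a b → a ≤ suc b) (sym (C-out-suc S t t′ v m)) (sym (C-out-suc S t t′ v m′))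
    (emit-balanced (pointerAt S (suc t) v) (sum (λ j → C G S t t′ (reverse v j))) m m′)

  Forwarding : State G → ℕ → (v : Fin n) → Permutation (deg v) (deg v) → Set
  Forwarding S Δt v π = ∀ j t → t < Δt → L G S t (reverse v j) ≡ L G S (suc t) (v , π ⟨$⟩ʳ j)

  reverse-index : ∀ {v} (e : InArc G v) → reverse v (Inverse.from (reverseIn-↔ v) e) ≡ inArc G e
  reverse-index {v} e = cong (inArc G) (Inverse.strictlyInverseˡ (reverseIn-↔ v) e)

  subcycle⇒forwarding : ∀ {S Δt} → SubcycleDecomposition G S Δt → ∀ v → ∃ (Forwarding S Δt v)
  subcycle⇒forwarding sd v = ↔-trans (reverseIn-↔ v) (⤖⇒↔ (proj₁ (sd v))) , λ j → proj₂ (sd v) (reverseIn v j)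

  forwarding⇒subcycle : ∀ {S Δt} → (∀ v → ∃ (Forwarding S Δt v)) → SubcycleDecomposition G S Δt
  forwarding⇒subcycle {S} fwd v = ↔⇒⤖ (↔-trans (↔-sym (reverseIn-↔ v)) (proj₁ (fwd v))) , λ e t t<Δt →
    trans (cong (L G S t) (sym (reverse-index e))) (proj₂ (fwd v) (Inverse.from (reverseIn-↔ v) e) t t<Δt)

  forwarding⇒C-shift : ∀ S Δt v π → Forwarding S Δt v π → ∀ j {t t′} → InWindow G Δt t t′ →
                       C G S t t′ (reverse v j) ≡ C G S (suc t) (suc t′) (v , π ⟨$⟩ʳ j)
  forwarding⇒C-shift S Δt v π fwd j {t} {t′} (t≤t′ , t′≤Δt) = begin
    C G S t t′ (reverse v j)                                  ≡⟨ C≡sumUpTo S t t′ (reverse v j) ⟩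
    sumUpTo (t′ ∸ t) (λ s → L G S (t + s) (reverse v j))      ≡⟨ sumUpTo-cong (t′ ∸ t) (λ s s<t′∸t → fwd j (t + s) (t+s<Δt s<t′∸t)) ⟩
    sumUpTo (t′ ∸ t) (λ s → L G S (suc t + s) (v , π ⟨$⟩ʳ j)) ≡⟨ C≡sumUpTo S (suc t) (suc t′) (v , π ⟨$⟩ʳ j) ⟨
    C G S (suc t) (suc t′) (v , π ⟨$⟩ʳ j)                     ∎
    where
    open ≡-Reasoning
    t+s<Δt : ∀ {s} → s < t′ ∸ t → t + s < Δt
    t+s<Δt s<t′∸t = ≤-trans (+-monoʳ-< t s<t′∸t) (≤-trans (≤-reflexive (m+[n∸m]≡n t≤t′)) t′≤Δt)

  multiplicity-inList : ∀ k (f : Arc G → ℕ) v →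
                        multiplicity _≟_ k (map f (inList G v)) ≡ sum (λ j → 𝟙 (does (f (reverse v j) ≟ k)))
  multiplicity-inList k f v = trans (multiplicity-map _≟_ k f (inList G v)) (sum-inList _ v)

  multiplicity-outList : ∀ k (f : Arc G → ℕ) v →
                         multiplicity _≟_ k (map f (outList G v)) ≡ sum (λ i → 𝟙 (does (f (v , i) ≟ k)))
  multiplicity-outList k f v = trans (multiplicity-map _≟_ k f (outList G v)) (sum-outList _ v)

  multiplicity-allArcs : ∀ k (f : Arc G → ℕ) → multiplicity _≟_ k (map f (allArcs G)) ≡ ∑ᴬ (λ e → 𝟙 (does (f e ≟ k)))
  multiplicity-allArcs k f = trans (multiplicity-map _≟_ k f (allArcs G)) (sum-allArcs _)

  subcycle⇒CondII : ∀ S Δt → SubcycleDecomposition G S Δt → CondII G S Δt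
  subcycle⇒CondII S Δt sd v t t′ window with subcycle⇒forwarding sd v
  ... | π , fwd = ↭-by-multiplicity _≟_ _ _ λ k → begin
    multiplicity _≟_ k (map (C G S t t′) (inList G v))              ≡⟨ multiplicity-inList k _ v ⟩
    sum (λ j → 𝟙 (does (C G S t t′ (reverse v j) ≟ k)))             ≡⟨ sum-cong-≗ {deg v} (λ j → cong (λ c → 𝟙 (does (c ≟ k))) (forwarding⇒C-shift S Δt v π fwd j window)) ⟩
    sum (λ j → 𝟙 (does (C′ (v , π ⟨$⟩ʳ j) ≟ k)))                    ≡⟨ ∑-permute (λ m → 𝟙 (does (C′ (v , m) ≟ k))) π ⟨
    sum (λ m → 𝟙 (does (C′ (v , m) ≟ k)))                           ≡⟨ multiplicity-outList k _ v ⟨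
    multiplicity _≟_ k (map C′ (outList G v))                       ∎
    where
    open ≡-Reasoning
    C′ = C G S (suc t) (suc t′)

  CondII⇒CondIII : ∀ S Δt → CondII G S Δt → CondIII G S Δt
  CondII⇒CondIII S Δt c2 t t′ window = ↭-by-multiplicity _≟_ _ _ λ k → begin
    multiplicity _≟_ k (map (C G S t t′) (allArcs G))                  ≡⟨ multiplicity-allArcs k _ ⟩
    ∑ᴬ (λ e → 𝟙 (does (C G S t t′ e ≟ k)))                             ≡⟨ ∑ᴬ-by-head _ ⟩
    sum (λ w → sum (λ j → 𝟙 (does (C G S t t′ (reverse w j) ≟ k))))    ≡⟨ sum-cong-≗ (λ w → in≡out k w) ⟩
    ∑ᴬ (λ e → 𝟙 (does (C′ e ≟ k)))                                    ≡⟨ multiplicity-allArcs k _ ⟨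
    multiplicity _≟_ k (map C′ (allArcs G))                            ∎
    where
    open ≡-Reasoning
    C′ = C G S (suc t) (suc t′)
    in≡out : ∀ k w → sum (λ j → 𝟙 (does (C G S t t′ (reverse w j) ≟ k))) ≡ sum (λ i → 𝟙 (does (C′ (w , i) ≟ k)))
    in≡out k w = begin
      sum (λ j → 𝟙 (does (C G S t t′ (reverse w j) ≟ k))) ≡⟨ multiplicity-inList k _ w ⟨
      multiplicity _≟_ k (map (C G S t t′) (inList G w))  ≡⟨ sum-map-↭ _ (c2 w t t′ window) ⟩
      multiplicity _≟_ k (map C′ (outList G w))           ≡⟨ multiplicity-outList k _ w ⟩
      sum (λ i → 𝟙 (does (C′ (w , i) ≟ k)))               ∎

  Φ-stateAt : ∀ S i s → Φ G i (stateAt G S s) ≡ ∑ᴬ (λ e → C G S s (s + i) e ^ 2)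
  Φ-stateAt S i s = trans (sumArcs≡∑ᴬ _) (∑ᴬ-cong (λ e → cong (_^ 2) (C-stateAt S s i e)))

  ∑ᴬ²-↭ : ∀ {f g : Arc G → ℕ} → map f (allArcs G) ↭ map g (allArcs G) → ∑ᴬ (λ e → f e ^ 2) ≡ ∑ᴬ (λ e → g e ^ 2)
  ∑ᴬ²-↭ {f} {g} f↭g = begin
    ∑ᴬ (λ e → f e ^ 2)                           ≡⟨ sum-allArcs _ ⟨
    List.sum (map (λ e → f e ^ 2) (allArcs G))   ≡⟨ cong List.sum (Listₚ.map-∘ (allArcs G)) ⟩
    List.sum (map (_^ 2) (map f (allArcs G)))    ≡⟨ sum-map-↭ (_^ 2) f↭g ⟩
    List.sum (map (_^ 2) (map g (allArcs G)))    ≡⟨ cong List.sum (Listₚ.map-∘ (allArcs G)) ⟨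
    List.sum (map (λ e → g e ^ 2) (allArcs G))   ≡⟨ sum-allArcs _ ⟩
    ∑ᴬ (λ e → g e ^ 2)                           ∎
    where open ≡-Reasoning

  CondIII⇒CondIV : ∀ S Δt → CondIII G S Δt → CondIV G S Δt
  CondIII⇒CondIV S Δt c3 i i≤Δt = Φ-constant
    where
    Φ-step : ∀ s → s + i ≤ Δt → Φ G i (stateAt G S (suc s)) ≡ Φ G i (stateAt G S s)
    Φ-step s s+i≤Δt = trans (Φ-stateAt S i (suc s))
      (trans (∑ᴬ²-↭ (↭-sym (c3 s (s + i) (m≤m+n s i , s+i≤Δt)))) (sym (Φ-stateAt S i s)))
    Φ-constant : ∀ s → s ≤ Δt ∸ i + 1 → Φ G i (stateAt G S s) ≡ Φ G i S
    Φ-constant zero    _       = refl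
    Φ-constant (suc s) 1+s≤Δt∸i+1 = trans (Φ-step s s+i≤Δt) (Φ-constant s (≤-trans (n≤1+n s) 1+s≤Δt∸i+1))
      where
      s≤Δt∸i : s ≤ Δt ∸ i
      s≤Δt∸i = ≤-pred (subst (suc s ≤_) (+-comm (Δt ∸ i) 1) 1+s≤Δt∸i+1)
      s+i≤Δt : s + i ≤ Δt
      s+i≤Δt = ≤-trans (+-monoˡ-≤ i s≤Δt∸i) (≤-reflexive (m∸n+n≡m i≤Δt))

  CondIV⇒window-∑²-invariant : ∀ S Δt → CondIV G S Δt → ∀ {t t′} → InWindow G Δt t t′ →
                               ∑ᴬ (λ e → C G S (suc t) (suc t′) e ^ 2) ≡ ∑ᴬ (λ e → C G S t t′ e ^ 2)
  CondIV⇒window-∑²-invariant S Δt c4 {t} {t′} (t≤t′ , t′≤Δt) = begin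
    ∑ᴬ (λ e → C G S (suc t) (suc t′) e ^ 2)      ≡⟨ cong (λ u → ∑ᴬ (λ e → C G S (suc t) (suc u) e ^ 2)) t+i≡t′ ⟨
    ∑ᴬ (λ e → C G S (suc t) (suc t + i) e ^ 2)   ≡⟨ Φ-stateAt S i (suc t) ⟨
    Φ G i (stateAt G S (suc t))                  ≡⟨ c4 i i≤Δt (suc t) 1+t≤Δt∸i+1 ⟩
    Φ G i S                                      ≡⟨ c4 i i≤Δt t (≤-trans (n≤1+n t) 1+t≤Δt∸i+1) ⟨
    Φ G i (stateAt G S t)                        ≡⟨ Φ-stateAt S i t ⟩
    ∑ᴬ (λ e → C G S t (t + i) e ^ 2)             ≡⟨ cong (λ u → ∑ᴬ (λ e → C G S t u e ^ 2)) t+i≡t′ ⟩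
    ∑ᴬ (λ e → C G S t t′ e ^ 2)                  ∎
    where
    open ≡-Reasoning
    i = t′ ∸ t
    t+i≡t′ : t + i ≡ t′
    t+i≡t′ = m+[n∸m]≡n t≤t′
    i≤Δt : i ≤ Δt
    i≤Δt = ≤-trans (m∸n≤m t′ t) t′≤Δt
    1+t≤Δt∸i+1 : suc t ≤ Δt ∸ i + 1
    1+t≤Δt∸i+1 = subst (suc t ≤_) (+-comm 1 (Δt ∸ i)) (s≤s (m+n≤o⇒m≤o∸n t (≤-trans (≤-reflexive t+i≡t′) t′≤Δt)))

  -- Per vertex the balanced out-counts have the least ∑² among vectors with the in-counts' sum,
  -- so equality of the totals forces equality at every vertex, hence balanced in-counts.
  CondIV⇒CondV : ∀ S Δt → CondIV G S Δt → CondV G S Δt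
  CondIV⇒CondV S Δt c4 v e₁ e₂ t t′ window =
    subst₂ (λ a b → ∣ a - b ∣ ≤ 1) (cong (C G S t t′) (reverse-index e₁)) (cong (C G S t t′) (reverse-index e₂))
      (∑²-minimal⇒balanced (x v) (y v) (C-out-balanced S t t′ v) (∑x≡∑y v) (∑²-equal v) (index e₁) (index e₂))
    where
    open ≡-Reasoning
    index = Inverse.from (reverseIn-↔ v)
    x y : ∀ w → Fin (deg w) → ℕ
    x w j = C G S t t′ (reverse w j)
    y w m = C G S (suc t) (suc t′) (w , m)
    ∑x≡∑y : ∀ w → sum (x w) ≡ sum (y w)
    ∑x≡∑y w = sym (flow-conservation S t t′ w)
    ∑²-equal : ∀ w → sum (λ m → y w m ^ 2) ≡ sum (λ j → x w j ^ 2)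
    ∑²-equal = pointwise-≤∧sum-≡⇒≗ (λ w → balanced-minimises-∑² (x w) (y w) (C-out-balanced S t t′ w) (∑x≡∑y w)) (begin
      ∑ᴬ (λ e → C G S (suc t) (suc t′) e ^ 2)   ≡⟨ CondIV⇒window-∑²-invariant S Δt c4 window ⟩
      ∑ᴬ (λ e → C G S t t′ e ^ 2)               ≡⟨ ∑ᴬ-by-head _ ⟩
      sum (λ w → sum (λ j → x w j ^ 2))         ∎)

  -- In-counters and out-counters of v are each pairwise balanced on every window and have equal totals,
  -- so they can be matched; differencing the matched cumulative counts gives the forwarding.
  CondV⇒subcycle : ∀ S Δt → CondV G S Δt → SubcycleDecomposition G S Δt
  CondV⇒subcycle S Δt c5 = forwarding⇒subcycle forwarding
    where
    forwarding : ∀ v → ∃ (Forwarding S Δt v)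
    forwarding v = σ , λ j t t<Δt → +-cancelˡ-≡ (C G S 0 t (reverse v j)) _ _ (begin
      C G S 0 t (reverse v j) + L G S t (reverse v j)                 ≡⟨ cong (C G S 0 t (reverse v j) +_) (C-single S t _) ⟨
      C G S 0 t (reverse v j) + C G S t (suc t) (reverse v j)         ≡⟨ C-+ S _ z≤n (n≤1+n t) ⟨
      C G S 0 (suc t) (reverse v j)                                   ≡⟨ a≡b j (suc t) t<Δt ⟩
      C G S 1 (suc (suc t)) (v , σ ⟨$⟩ʳ j)                             ≡⟨ C-+ S _ (s≤s z≤n) (n≤1+n (suc t)) ⟩
      C G S 1 (suc t) (v , σ ⟨$⟩ʳ j) + C G S (suc t) (suc (suc t)) (v , σ ⟨$⟩ʳ j)
        ≡⟨ cong₂ _+_ (sym (a≡b j t (<⇒≤ t<Δt))) (C-single S (suc t) _) ⟩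
      C G S 0 t (reverse v j) + L G S (suc t) (v , σ ⟨$⟩ʳ j)          ∎)
      where
      open ≡-Reasoning
      a b : Fin (deg v) → ℕ → ℕ
      a j t = C G S 0 t (reverse v j)
      b m t = C G S 1 (suc t) (v , m)
      a-gains : ∀ j k → GainsAtMostOne Δt (a j) (a k)
      a-gains j k = increments⇒gains Δt λ {t} {t′} t≤t′ t′≤Δt →
        C G S t t′ (reverse v j) , C G S t t′ (reverse v k) , C-+ S _ z≤n t≤t′ , C-+ S _ z≤n t≤t′ ,
        ∣m-n∣≤1⇒m≤1+n (c5 v (reverseIn v j) (reverseIn v k) t t′ (t≤t′ , t′≤Δt))
      b-gains : ∀ m m′ → GainsAtMostOne Δt (b m) (b m′)
      b-gains m m′ = increments⇒gains Δt λ {t} {t′} t≤t′ t′≤Δt →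
        C G S (suc t) (suc t′) (v , m) , C G S (suc t) (suc t′) (v , m′) ,
        C-+ S _ (s≤s z≤n) (s≤s t≤t′) , C-+ S _ (s≤s z≤n) (s≤s t≤t′) , C-out-balanced S t t′ v m m′
      matching = counters-matching Δt a b a-gains b-gains (λ _ → refl) (λ _ → refl) (λ t _ → sym (flow-conservation S 0 t v))
      σ = proj₁ matching
      a≡b = proj₂ matching

lemma3 : (G : Graph) (S : State G) (Δt : ℕ) → 1 ≤ Δt →
    (SubcycleDecomposition G S Δt ⇔ CondII G S Δt)
    × (SubcycleDecomposition G S Δt ⇔ CondIII G S Δt)
    × (SubcycleDecomposition G S Δt ⇔ CondIV G S Δt)
    × (SubcycleDecomposition G S Δt ⇔ CondV G S Δt)
lemma3 G S Δt _ =
    mk⇔ i⇒ii (v⇒i ∘ iv⇒v ∘ iii⇒iv ∘ ii⇒iii)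
  , mk⇔ (ii⇒iii ∘ i⇒ii) (v⇒i ∘ iv⇒v ∘ iii⇒iv)
  , mk⇔ (iii⇒iv ∘ ii⇒iii ∘ i⇒ii) (v⇒i ∘ iv⇒v)
  , mk⇔ (iv⇒v ∘ iii⇒iv ∘ ii⇒iii ∘ i⇒ii) v⇒i
  where
  i⇒ii    = subcycle⇒CondII G S Δt
  ii⇒iii  = CondII⇒CondIII G S Δt
  iii⇒iv  = CondIII⇒CondIV G S Δt
  iv⇒v    = CondIV⇒CondV G S Δt
  v⇒i     = CondV⇒subcycle G S Δt
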